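{- Let $L=\{(x,\sqrt2\,y): x,y\in\mathbb{Z}\}\subset\mathbb{R}^2$. Then no three points of $L$ form the vertices of a non-degenerate equilateral triangle. -}

module Defs where

open import Data.Integer using (ℤ; _+_; _-_; _*_)
open import Data.Product using (_×_; _,_)

-- A point of L = {(x, √2 y) : x, y ∈ ℤ} ⊂ ℝ² is represented by its
-- integer coordinates (x , y), i.e. the pair (x , y) stands for (x , √2·y).
L-Point : Set
L-Point = ℤ × ℤ

-- Squared Euclidean distance in ℝ² between (x₁, √2 y₁) and (x₂, √2 y₂):
--   (x₁ - x₂)² + (√2 y₁ - √2 y₂)² = (x₁ - x₂)² + 2 (y₁ - y₂)²,
-- which is an integer.
dist² : L-Point → L-Point → ℤ
dist² (x₁ , y₁) (x₂ , y₂) =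
  (x₁ - x₂) * (x₁ - x₂) + 2ℤ * ((y₁ - y₂) * (y₁ - y₂))
  where
  open import Data.Integer using (+_)
  2ℤ : ℤ
  2ℤ = + 2

NonDegEquilateral : L-Point → L-Point → L-Point → Set
NonDegEquilateral p q r =
  (p ≢ q) × (dist² p q ≡ dist² q r) × (dist² q r ≡ dist² r p)
  where
  open import Relation.Binary.PropositionalEquality using (_≡_; _≢_)

{-# OPTIONS --safe #-}
-- Let u = p − q and v = r − q. Polarisation gives 2⟨u, v⟩ = |u|² + |v|² − |u − v|², and
-- Lagrange's identity gives |u|² |v|² = ⟨u, v⟩² + (u × v)², where on L the numbers ⟨u, v⟩
-- and (u × v)/√2 are integers. If all three sides have squared length s, then s = 2⟨u, v⟩
-- and s² = ⟨u, v⟩² + (u × v)², so 3⟨u, v⟩² = 2((u × v)/√2)². As √(3/2) is irrational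
-- (by descent: any integer solution of 3m² = 2n² halves to another), ⟨u, v⟩ = 0, so s = 0.
module Submission where

open import Defs
open import Relation.Nullary using (¬_)

module ℕ-Descent where
  open import Data.Nat
  open import Data.Nat.Properties
  open import Data.Nat.Divisibility
  open import Data.Nat.Coprimality using (Coprime; coprime?; coprime-divisor)
  open import Data.Nat.Primality using (Prime; prime?; euclidsLemma)
  open import Data.Nat.Induction using (<-wellFounded)
  open import Data.Nat.Tactic.RingSolver using (solve-∀)
  open import Data.Product using (∃; _×_; _,_)
  open import Data.Sum using ([_,_]′)
  open import Function using (id)
  open import Induction.WellFounded using (Acc; acc)
  open import Relation.Binary.PropositionalEquality
  open import Relation.Nullary.Decidable using (from-yes)

  halving-descent : (P : ℕ → Set) → (∀ {m} → P m → ∃ λ n → m ≡ n * 2 × P n) →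
                    ∀ {m} → P m → m ≡ 0
  halving-descent P halve = go (<-wellFounded _)
    where
    go : ∀ {m} → Acc _<_ m → P m → m ≡ 0
    go {zero}  _         _  = refl
    go {suc m} (acc rec) Pm with halve Pm
    ... | zero  , () , _
    ... | suc n , refl , Pn = cong (_* 2) (go (rec (m<m*n (suc n) 2 (n<1+n 1))) Pn)

  prime∣n*n⇒∣n : ∀ {p n} → Prime p → p ∣ n * n → p ∣ n
  prime∣n*n⇒∣n {n = n} p-prime p∣n*n = [ id , id ]′ (euclidsLemma n n p-prime p∣n*n)

  2∣n*n⇒2∣n : ∀ {n} → 2 ∣ n * n → 2 ∣ n
  2∣n*n⇒2∣n = prime∣n*n⇒∣n (from-yes (prime? 2))

  3m²≡2n²⇒2∣m : ∀ m n → 3 * (m * m) ≡ 2 * (n * n) → 2 ∣ m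
  3m²≡2n²⇒2∣m m n eq =
    2∣n*n⇒2∣n (coprime-divisor 2⊥3 (subst (2 ∣_) (sym eq) (m∣m*n (n * n))))
    where
    2⊥3 : Coprime 2 3
    2⊥3 = from-yes (coprime? 2 3)

  3[2m]²≡2n²⇒2∣n : ∀ m n → 3 * ((m * 2) * (m * 2)) ≡ 2 * (n * n) → 2 ∣ n
  3[2m]²≡2n²⇒2∣n m n eq = 2∣n*n⇒2∣n (divides (3 * (m * m)) n²≡3m²*2)
    where
    3[2m]²≡2*[3m²*2] : ∀ m → 3 * ((m * 2) * (m * 2)) ≡ 2 * (3 * (m * m) * 2)
    3[2m]²≡2*[3m²*2] = solve-∀
    n²≡3m²*2 : n * n ≡ 3 * (m * m) * 2
    n²≡3m²*2 = *-cancelˡ-≡ (n * n) (3 * (m * m) * 2) 2 (trans (sym eq) (3[2m]²≡2*[3m²*2] m))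

  3[2m]²≡2[2n]²⇒3m²≡2n² : ∀ m n → 3 * ((m * 2) * (m * 2)) ≡ 2 * ((n * 2) * (n * 2)) →
                          3 * (m * m) ≡ 2 * (n * n)
  3[2m]²≡2[2n]²⇒3m²≡2n² m n eq = *-cancelˡ-≡ (3 * (m * m)) (2 * (n * n)) 4 (begin
    4 * (3 * (m * m))        ≡⟨ 4[cm²]≡c[2m]² 3 m ⟩
    3 * ((m * 2) * (m * 2))  ≡⟨ eq ⟩
    2 * ((n * 2) * (n * 2))  ≡⟨ 4[cm²]≡c[2m]² 2 n ⟨
    4 * (2 * (n * n))        ∎)
    where
    open ≡-Reasoning
    4[cm²]≡c[2m]² : ∀ c m → 4 * (c * (m * m)) ≡ c * ((m * 2) * (m * 2))
    4[cm²]≡c[2m]² = solve-∀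

  halve-3m²≡2n² : ∀ {m} → (∃ λ n → 3 * (m * m) ≡ 2 * (n * n)) →
                  ∃ λ m′ → m ≡ m′ * 2 × ∃ λ n′ → 3 * (m′ * m′) ≡ 2 * (n′ * n′)
  halve-3m²≡2n² {m} (n , eq) with 3m²≡2n²⇒2∣m m n eq
  ... | divides-refl m′ with 3[2m]²≡2n²⇒2∣n m′ n eq
  ... | divides-refl n′ = m′ , refl , n′ , 3[2m]²≡2[2n]²⇒3m²≡2n² m′ n′ eq

  3m²≡2n²⇒m≡0 : ∀ m n → 3 * (m * m) ≡ 2 * (n * n) → m ≡ 0
  3m²≡2n²⇒m≡0 _ n eq =
    halving-descent (λ m → ∃ λ n → 3 * (m * m) ≡ 2 * (n * n)) halve-3m²≡2n² (n , eq)

open import Data.Integer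
open import Data.Integer.Properties
open import Data.Integer.Tactic.RingSolver using (solve-∀)
import Data.Nat as ℕ
import Data.Nat.Properties as ℕ
open import Data.Product using (_×_; _,_)
open import Data.Sum using ([_,_]′)
open import Function using (id)
open import Relation.Binary.PropositionalEquality
open ℕ-Descent using (3m²≡2n²⇒m≡0)

i*i≡+∣i∣*∣i∣ : ∀ i → i * i ≡ + (∣ i ∣ ℕ.* ∣ i ∣)
i*i≡+∣i∣*∣i∣ (+ n)    = sym (pos-* n n)
i*i≡+∣i∣*∣i∣ -[1+ n ] = refl

∣c*[i*i]∣≡c*∣i∣*∣i∣ : ∀ c i → ∣ + c * (i * i) ∣ ≡ c ℕ.* (∣ i ∣ ℕ.* ∣ i ∣)
∣c*[i*i]∣≡c*∣i∣*∣i∣ c i = trans (abs-* (+ c) (i * i)) (cong (c ℕ.*_) (abs-* i i))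

3i²≡2j²⇒i≡0 : ∀ i j → + 3 * (i * i) ≡ + 2 * (j * j) → i ≡ 0ℤ
3i²≡2j²⇒i≡0 i j eq = ∣i∣≡0⇒i≡0 (3m²≡2n²⇒m≡0 ∣ i ∣ ∣ j ∣ (begin
  3 ℕ.* (∣ i ∣ ℕ.* ∣ i ∣)  ≡⟨ sym (∣c*[i*i]∣≡c*∣i∣*∣i∣ 3 i) ⟩
  ∣ + 3 * (i * i) ∣        ≡⟨ cong ∣_∣ eq ⟩
  ∣ + 2 * (j * j) ∣        ≡⟨ ∣c*[i*i]∣≡c*∣i∣*∣i∣ 2 j ⟩
  2 ℕ.* (∣ j ∣ ℕ.* ∣ j ∣)  ∎))
  where open ≡-Reasoning

i²+2j²≡0⇒i≡0×j≡0 : ∀ i j → i * i + + 2 * (j * j) ≡ 0ℤ → i ≡ 0ℤ × j ≡ 0ℤ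
i²+2j²≡0⇒i≡0×j≡0 i j eq = ∣i∣≡0⇒i≡0 (square≡0 ∣ i ∣ a≡0) , ∣i∣≡0⇒i≡0 (square≡0 ∣ j ∣ b≡0)
  where
  open ≡-Reasoning
  a b : ℕ.ℕ
  a = ∣ i ∣ ℕ.* ∣ i ∣
  b = ∣ j ∣ ℕ.* ∣ j ∣
  a+2b≡0 : a ℕ.+ 2 ℕ.* b ≡ 0
  a+2b≡0 = +-injective (begin
    + (a ℕ.+ 2 ℕ.* b)      ≡⟨ pos-+ a (2 ℕ.* b) ⟩
    + a + + (2 ℕ.* b)      ≡⟨ cong (_+_ (+ a)) (pos-* 2 b) ⟩
    + a + + 2 * + b        ≡⟨ cong₂ (λ x y → x + + 2 * y) (i*i≡+∣i∣*∣i∣ i) (i*i≡+∣i∣*∣i∣ j) ⟨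
    i * i + + 2 * (j * j)  ≡⟨ eq ⟩
    0ℤ                     ∎)
  a≡0 : a ≡ 0
  a≡0 = ℕ.m+n≡0⇒m≡0 a a+2b≡0
  b≡0 : b ≡ 0
  b≡0 = ℕ.m*n≡0⇒m≡0 b 2 (trans (ℕ.*-comm b 2) (ℕ.m+n≡0⇒n≡0 a a+2b≡0))
  square≡0 : ∀ n → n ℕ.* n ≡ 0 → n ≡ 0
  square≡0 n n*n≡0 = [ id , id ]′ (ℕ.m*n≡0⇒m≡0∨n≡0 n n*n≡0)

-- Reading p, q, r as the points (x, √2 y) of ℝ², inner p q r is the inner product of
-- p − q and r − q, and their cross product is √2 · cross p q r.
inner : L-Point → L-Point → L-Point → ℤ
inner (x₁ , y₁) (x₂ , y₂) (x₃ , y₃) = (x₁ - x₂) * (x₃ - x₂) + + 2 * ((y₁ - y₂) * (y₃ - y₂))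

cross : L-Point → L-Point → L-Point → ℤ
cross (x₁ , y₁) (x₂ , y₂) (x₃ , y₃) = (x₁ - x₂) * (y₃ - y₂) - (y₁ - y₂) * (x₃ - x₂)

polarisation : ∀ p q r → + 2 * inner p q r ≡ dist² p q + dist² q r - dist² r p
polarisation (x₁ , y₁) (x₂ , y₂) (x₃ , y₃) = identity x₁ y₁ x₂ y₂ x₃ y₃
  where
  identity : ∀ x₁ y₁ x₂ y₂ x₃ y₃ →
    + 2 * ((x₁ - x₂) * (x₃ - x₂) + + 2 * ((y₁ - y₂) * (y₃ - y₂)))
      ≡ (x₁ - x₂) * (x₁ - x₂) + + 2 * ((y₁ - y₂) * (y₁ - y₂))
        + ((x₂ - x₃) * (x₂ - x₃) + + 2 * ((y₂ - y₃) * (y₂ - y₃)))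
        - ((x₃ - x₁) * (x₃ - x₁) + + 2 * ((y₃ - y₁) * (y₃ - y₁)))
  identity = solve-∀

lagrange-identity : ∀ p q r →
  dist² p q * dist² q r ≡ inner p q r * inner p q r + + 2 * (cross p q r * cross p q r)
lagrange-identity (x₁ , y₁) (x₂ , y₂) (x₃ , y₃) = identity x₁ y₁ x₂ y₂ x₃ y₃
  where
  identity : ∀ x₁ y₁ x₂ y₂ x₃ y₃ →
    ((x₁ - x₂) * (x₁ - x₂) + + 2 * ((y₁ - y₂) * (y₁ - y₂)))
      * ((x₂ - x₃) * (x₂ - x₃) + + 2 * ((y₂ - y₃) * (y₂ - y₃)))
    ≡ ((x₁ - x₂) * (x₃ - x₂) + + 2 * ((y₁ - y₂) * (y₃ - y₂)))
        * ((x₁ - x₂) * (x₃ - x₂) + + 2 * ((y₁ - y₂) * (y₃ - y₂)))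
      + + 2 * (((x₁ - x₂) * (y₃ - y₂) - (y₁ - y₂) * (x₃ - x₂))
               * ((x₁ - x₂) * (y₃ - y₂) - (y₁ - y₂) * (x₃ - x₂)))
  identity = solve-∀

module _ (p q r : L-Point) (pq≡qr : dist² p q ≡ dist² q r) (qr≡rp : dist² q r ≡ dist² r p) where
  open ≡-Reasoning

  equilateral⇒2inner≡side : + 2 * inner p q r ≡ dist² p q
  equilateral⇒2inner≡side = begin
    + 2 * inner p q r                     ≡⟨ polarisation p q r ⟩
    dist² p q + dist² q r - dist² r p     ≡⟨ cong (λ b → dist² p q + b - dist² r p) qr≡rp ⟩
    dist² p q + dist² r p - dist² r p     ≡⟨ a+b-b≡a (dist² p q) (dist² r p) ⟩
    dist² p q                             ∎
    where
    a+b-b≡a : ∀ a b → a + b - b ≡ a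
    a+b-b≡a = solve-∀

  equilateral⇒3inner²≡2cross² : + 3 * (inner p q r * inner p q r) ≡ + 2 * (cross p q r * cross p q r)
  equilateral⇒3inner²≡2cross² = begin
    + 3 * (M * M)                   ≡⟨ 3M²≡[2M]²-M² M ⟩
    + 2 * M * (+ 2 * M) - M * M     ≡⟨ cong (λ a → a * a - M * M) equilateral⇒2inner≡side ⟩
    dist² p q * dist² p q - M * M   ≡⟨ cong (λ b → dist² p q * b - M * M) pq≡qr ⟩
    dist² p q * dist² q r - M * M   ≡⟨ cong (_- M * M) (lagrange-identity p q r) ⟩
    M * M + + 2 * (K * K) - M * M   ≡⟨ a+b-a≡b (M * M) (+ 2 * (K * K)) ⟩
    + 2 * (K * K)                   ∎
    where
    M K : ℤ
    M = inner p q r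
    K = cross p q r
    3M²≡[2M]²-M² : ∀ M → + 3 * (M * M) ≡ + 2 * M * (+ 2 * M) - M * M
    3M²≡[2M]²-M² = solve-∀
    a+b-a≡b : ∀ a b → a + b - a ≡ b
    a+b-a≡b = solve-∀

dist²≡0⇒≡ : ∀ p q → dist² p q ≡ 0ℤ → p ≡ q
dist²≡0⇒≡ (x₁ , y₁) (x₂ , y₂) d≡0 with i²+2j²≡0⇒i≡0×j≡0 (x₁ - x₂) (y₁ - y₂) d≡0
... | Δx≡0 , Δy≡0 = cong₂ _,_ (i-j≡0⇒i≡j x₁ x₂ Δx≡0) (i-j≡0⇒i≡j y₁ y₂ Δy≡0)

lemma4p3 : (p q r : L-Point) → ¬ NonDegEquilateral p q r
lemma4p3 p q r (p≢q , pq≡qr , qr≡rp) = p≢q (dist²≡0⇒≡ p q side≡0)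
  where
  open ≡-Reasoning
  inner≡0 : inner p q r ≡ 0ℤ
  inner≡0 = 3i²≡2j²⇒i≡0 (inner p q r) (cross p q r)
              (equilateral⇒3inner²≡2cross² p q r pq≡qr qr≡rp)
  side≡0 : dist² p q ≡ 0ℤ
  side≡0 = begin
    dist² p q          ≡⟨ sym (equilateral⇒2inner≡side p q r pq≡qr qr≡rp) ⟩
    + 2 * inner p q r  ≡⟨ cong (+ 2 *_) inner≡0 ⟩
    0ℤ                 ∎
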